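{- Let $\Psi = \Pi:\varphi$ be a DQBF, let $C$ be a clause compatible with $\Psi$, and let $V' = \mathrm{dep}(C)$. If $\mathrm{abs}(\Pi:\varphi\land\neg C, V') \vdash_{1\forall} \bot$, then $\Pi:\varphi \equiv \Pi:\varphi\land C$.
   Context: A DQBF over a finite set $V=\{x_1,\dots,x_n,y_1,\dots,y_m\}$ of Boolean variables has the form $\forall x_1\ldots\forall x_n\exists y_1(D_{y_1})\ldots\exists y_m(D_{y_m}):\varphi$, where $D_{y_i}\subseteq\{x_1,\dots,x_n\}$ is the dependency set of $y_i$ and the matrix $\varphi$ is a CNF over $V$, treated as a set of clauses, each clause a set of literals. The prefix is treated as a set $\Pi$ and the DQBF is written $\Pi:\varphi$. $V_\exists$ and $V_\forall$ denote the existential and universal variables. A clause is compatible with $\Psi$ if it contains only variables of $\Psi$. For a set $X$ of variables, $\mathcal{A}(X)$ is the set of assignments $X\to\{0,1\}$. A Skolem function for $\Psi$ is a family $(s_y)_{y\in V_\exists}$ with $s_y:\mathcal{A}(D_y)\to\{0,1\}$ such that replacing every $y$ by $s_y$ turns $\varphi$ into a tautology; $\Psi$ is satisfiable iff a Skolem function exists. Two DQBFs over the same existential and universal variables are equivalent ($\equiv$) iff they have exactly the same Skolem functions. Dependencies are defined by $\mathrm{dep}(v)=\{v\}$ if $v$ is universal and $\mathrm{dep}(v)=D_v$ if $v$ is existential. For a literal, $\mathrm{dep}(\ell)=\mathrm{dep}(\mathrm{var}(\ell))$; for a clause, $\mathrm{dep}(C)=\bigcup_{\ell\in C}\mathrm{dep}(\ell)$.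 $\Pi:\varphi\land C$ denotes $\Pi:\varphi\cup\{C\}$. $\Pi:\varphi\land\neg C$ denotes $\varphi$ together with the unit clauses $\{\neg\ell\}$ for all $\ell\in C$. Abstraction: for $V'\subseteq V_\forall$, $\mathrm{abs}(\Pi:\varphi,V')$ is the DQBF with the same matrix $\varphi$ in which each $v\in V'$ is removed as a universal variable, removed from all dependency sets, and instead quantified as $\exists v(\emptyset)$. Universal reduction: for a non-tautological clause $C$, $\mathrm{UR}(C)$ is obtained from $C$ by removing every universal literal $\ell$ for which no existential literal $k\in C$ has $\mathrm{var}(\ell)\in D_{\mathrm{var}(k)}$. Also $\mathrm{UR}(\Pi:\varphi)=\Pi:\{\mathrm{UR}(C)\mid C\in\varphi\}$. Unit propagation: let $U$ be the set of literals $\ell$ with $\{\ell\}\in\varphi$ and $\mathrm{var}(\ell)$ existential. Define $\mathrm{UP}^1(\Pi:\varphi)=\mathrm{UR}\bigl(\Pi\setminus\{\mathrm{var}(\ell)\mid\ell\in U\} : \{C\setminus\{\neg\ell\mid \ell\in U\}\mid C\in\varphi,\ C\cap U=\emptyset\}\bigr)$. Iterate to a fixpoint $\mathrm{UP}(\Pi:\varphi)$. Write $\Pi:\varphi\vdash_{1\forall}\bot$ (a conflict) if the empty clause belongs to $\mathrm{UP}(\Pi:\varphi)$. Otherwise write $\Pi:\varphi\vdash_{1\forall}U$, where $U$ is the set of all unit literals processed in all rounds. -}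

module Defs where

open import Data.Nat using (ℕ; suc; _≟_)
open import Data.Bool using (Bool; true; false; not; _∧_; if_then_else_)
open import Data.Bool.Properties using () renaming (_≟_ to _≟ᵇ_)
open import Data.Product using (_×_; _,_; proj₁; proj₂)
open import Data.Product.Properties using (≡-dec)
open import Data.Maybe using (Maybe; just; nothing; is-just; maybe′)
open import Data.List using (List; []; _∷_; [_]; _++_; map; filter; concatMap; length)
open import Data.Bool.ListAction using (any; all)
open import Data.List.Membership.Propositional using (_∈_; _∉_)
open import Data.List.Relation.Unary.All using (All)
open import Data.List.Relation.Unary.Any using (Any)
open import Data.List.Relation.Unary.Unique.Propositional using (Unique)
open import Relation.Binary.PropositionalEquality using (_≡_)
open import Relation.Nullary using (¬_)
open import Relation.Nullary.Decidable using (⌊_⌋)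
open import Function using (id)
open import Function.Bundles using (_⇔_)

import Data.List.Membership.DecPropositional as DecMem

-- Variables are natural numbers; a literal is a variable with a
-- polarity (true = positive literal v, false = negative literal ¬v).

Var : Set
Var = ℕ

Lit : Set
Lit = Var × Bool

var : Lit → Var
var = proj₁

neg : Lit → Lit
neg (v , b) = v , not b

_≟ₗ_ : (l k : Lit) → Relation.Nullary.Dec (l ≡ k)
_≟ₗ_ = ≡-dec _≟_ _≟ᵇ_

open DecMem _≟_ using () renaming (_∈?_ to _∈ᵥ?_)
open DecMem _≟ₗ_ using () renaming (_∈?_ to _∈ₗ?_)

-- clauses and CNFs, read as sets (membership semantics)
Clause : Set
Clause = List Lit

CNF : Set
CNF = List Clause

record DQBF : Set where
  constructor _∶_∶_
  field
    univ   : List Var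
    exis   : List (Var × List Var)
    matrix : CNF
open DQBF public

lookupD : List (Var × List Var) → Var → Maybe (List Var)
lookupD [] v = nothing
lookupD ((y , D) ∷ es) v = if ⌊ y ≟ v ⌋ then just D else lookupD es v

isExis : DQBF → Var → Bool
isExis Ψ v = is-just (lookupD (exis Ψ) v)

allVars : DQBF → List Var
allVars Ψ = univ Ψ ++ map proj₁ (exis Ψ)

Compatible : DQBF → Clause → Set
Compatible Ψ C = ∀ l → l ∈ C → var l ∈ allVars Ψ

record WellFormed (Ψ : DQBF) : Set where
  field
    disjoint   : ∀ v → v ∈ univ Ψ → v ∉ map proj₁ (exis Ψ)
    exisUnique : Unique (map proj₁ (exis Ψ))
    depsUniv   : ∀ y D → (y , D) ∈ exis Ψ → ∀ x → x ∈ D → x ∈ univ Ψ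
    matrixOK   : ∀ C → C ∈ matrix Ψ → Compatible Ψ C

-- Skolem functions.  A candidate is s : Var → (Var → Bool) → Bool, where
-- s y α is the value of y under the universal assignment α; it must be
-- local: s y depends only on α restricted to D_y.

Candidate : Set
Candidate = Var → (Var → Bool) → Bool

Local : DQBF → Candidate → Set
Local Ψ s = ∀ y D → (y , D) ∈ exis Ψ → ∀ (α β : Var → Bool) →
            (∀ x → x ∈ D → α x ≡ β x) → s y α ≡ s y β

valVar : DQBF → Candidate → (Var → Bool) → Var → Bool
valVar Ψ s α v = if isExis Ψ v then s v α else α v

valLit : DQBF → Candidate → (Var → Bool) → Lit → Bool
valLit Ψ s α (v , true)  = valVar Ψ s α v
valLit Ψ s α (v , false) = not (valVar Ψ s α v)

IsSkolem : DQBF → Candidate → Set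
IsSkolem Ψ s = Local Ψ s × (∀ (α : Var → Bool) →
               All (λ C → Any (λ l → valLit Ψ s α l ≡ true) C) (matrix Ψ))

_≡ₛ_ : DQBF → DQBF → Set
Ψ ≡ₛ Ψ' = ∀ (s : Candidate) → IsSkolem Ψ s ⇔ IsSkolem Ψ' s

_∧ᶜ_ : DQBF → Clause → DQBF
(Π ∶ E ∶ φ) ∧ᶜ C = Π ∶ E ∶ (φ ++ [ C ])

_∧¬_ : DQBF → Clause → DQBF
(Π ∶ E ∶ φ) ∧¬ C = Π ∶ E ∶ (φ ++ map (λ l → [ neg l ]) C)

dep : DQBF → Var → List Var
dep Ψ v = maybe′ id [ v ] (lookupD (exis Ψ) v)

depClause : DQBF → Clause → List Var
depClause Ψ C = concatMap (λ l → dep Ψ (var l)) C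

notIn : List Var → Var → Bool
notIn V' v = not ⌊ v ∈ᵥ? V' ⌋

abs : DQBF → List Var → DQBF
abs (Π ∶ E ∶ φ) V' =
  filter (λ v → Relation.Nullary.Decidable.T? (notIn V' v)) Π
  ∶ (map (λ p → proj₁ p , filter (λ v → Relation.Nullary.Decidable.T? (notIn V' v)) (proj₂ p)) E
     ++ map (λ v → v , []) V')
  ∶ φ

isTaut : Clause → Bool
isTaut C = any (λ l → ⌊ neg l ∈ₗ? C ⌋) C

depends : DQBF → Var → Lit → Bool
depends Ψ v k = maybe′ (λ D → ⌊ v ∈ᵥ? D ⌋) false (lookupD (exis Ψ) (var k))

keepLit : DQBF → Clause → Lit → Bool
keepLit Ψ C l = not ⌊ var l ∈ᵥ? univ Ψ ⌋ Data.Bool.∨ any (depends Ψ (var l)) C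

URc : DQBF → Clause → Clause
URc Ψ C = if isTaut C then C else filter (λ l → Relation.Nullary.Decidable.T? (keepLit Ψ C l)) C

UR : DQBF → DQBF
UR Ψ = univ Ψ ∶ exis Ψ ∶ map (URc Ψ) (matrix Ψ)

unitOf : Clause → Maybe Lit
unitOf [] = nothing
unitOf (l ∷ ls) = if all (λ k → ⌊ k ≟ₗ l ⌋) ls then just l else nothing

unitsU : DQBF → List Lit
unitsU Ψ = filter (λ l → Relation.Nullary.Decidable.T? (isExis Ψ (var l)))
                  (concatMap (λ C → maybe′ [_] [] (unitOf C)) (matrix Ψ))

UP1 : DQBF → DQBF
UP1 Ψ = UR (univ Ψ
             ∶ filter (λ p → Relation.Nullary.Decidable.T? (notIn (map var U) (proj₁ p))) (exis Ψ)
             ∶ map (filter (λ l → Relation.Nullary.Decidable.T? (not ⌊ neg l ∈ₗ? U ⌋)))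
                   (filter (λ C → Relation.Nullary.Decidable.T? (not (any (λ l → ⌊ l ∈ₗ? U ⌋) C)))
                           (matrix Ψ)))
  where U = unitsU Ψ

iter : ℕ → (DQBF → DQBF) → DQBF → DQBF
iter ℕ.zero f x = x
iter (suc n) f x = iter n f (f x)

-- UP reaches its fixpoint after at most (#existential entries + 1) rounds
UP : DQBF → DQBF
UP Ψ = iter (suc (length (exis Ψ))) UP1 Ψ

Conflict : DQBF → Set
Conflict Ψ = [] ∈ matrix (UP Ψ)

-- If a Skolem function s of Ψ falsified C at a universal assignment α, freezing the variables
-- of dep(C) at their α-values would turn s into a Skolem function of abs(Ψ ∧ ¬C, dep(C)).
-- Unit propagation with universal reduction preserves Skolem functions, so it never derives
-- the empty clause from a satisfiable DQBF. Hence every Skolem function of Ψ satisfies C; the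
-- converse is immediate.

module Submission where

open import Data.Bool using (Bool; true; false; not; _∨_; if_then_else_; T)
open import Data.Bool.Properties using (not-involutive; ¬-not; T-∧) renaming (_≟_ to _≟ᵇ_)
open import Data.Bool.ListAction using (any; all)
open import Data.Empty using (⊥-elim)
open import Data.List using (List; []; _∷_; [_]; _++_; map; filter; length)
open import Data.List.Membership.Propositional using (_∈_; _∉_; find; lose)
open import Data.List.Membership.Propositional.Properties
  using (∈-map⁻; ∈-filter⁺; ∈-filter⁻; ∈-++⁻; ∈-concatMap⁺; ∈-concatMap⁻)
open import Data.List.Relation.Unary.All using (All; []; _∷_; tabulate)
import Data.List.Relation.Unary.All as All
open import Data.List.Relation.Unary.All.Properties using (++⁺; ++⁻ˡ; map⁺)
open import Data.List.Relation.Unary.Any using (Any; here; there; any?)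
import Data.List.Relation.Unary.Any as Any
open import Data.List.Relation.Unary.Any.Properties using (any⁺; ¬Any[])
open import Data.Maybe using (just; nothing; maybe′; _<∣>_)
import Data.Maybe as Maybe
open import Data.Maybe.Properties using (<∣>-identityʳ)
open import Data.Nat using (zero; suc; _≟_)
open import Data.Product using (_×_; _,_; proj₁; proj₂; ∃)
open import Data.Sum using (_⊎_; inj₁; inj₂)
open import Function using (_∘_)
open import Function.Bundles using (mk⇔; Equivalence)
open import Relation.Binary.PropositionalEquality
  using (_≡_; refl; sym; trans; cong; cong₂; subst; module ≡-Reasoning)
open import Relation.Nullary using (¬_; Dec; yes; no; contradiction)
open import Relation.Nullary.Decidable
  using (⌊_⌋; T?; toWitness; fromWitness; toWitnessFalse; fromWitnessFalse)
import Data.List.Membership.DecPropositional as DecMem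

open import Defs

open DecMem _≟_ using () renaming (_∈?_ to _∈ᵥ?_)
open DecMem _≟ₗ_ using () renaming (_∈?_ to _∈ₗ?_)

¬T-not∨ : ∀ a {c} → ¬ T (not a ∨ c) → T a × ¬ T c
¬T-not∨ true ¬c = _ , ¬c
¬T-not∨ false ¬t = contradiction _ ¬t

T-not⇒¬T : ∀ b → T (not b) → ¬ T b
T-not⇒¬T false _ ()

T-all : ∀ {A : Set} (p : A → Bool) xs → T (all p xs) → ∀ {x} → x ∈ xs → T (p x)
T-all p (y ∷ ys) t (here refl) = proj₁ (Equivalence.to T-∧ t)
T-all p (y ∷ ys) t (there x∈) = T-all p ys (proj₂ (Equivalence.to T-∧ t)) x∈

⌊⌋-true : ∀ {P : Set} (d : Dec P) → P → ⌊ d ⌋ ≡ true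
⌊⌋-true (yes _) _ = refl
⌊⌋-true (no ¬p) p = contradiction p ¬p

⌊⌋-false : ∀ {P : Set} (d : Dec P) → ¬ P → ⌊ d ⌋ ≡ false
⌊⌋-false (yes p) ¬p = contradiction p ¬p
⌊⌋-false (no _) _ = refl

polarity : ∀ x b b′ → (x , b′) ≡ (x , b) ⊎ (x , b′) ≡ neg (x , b)
polarity x true true = inj₁ refl
polarity x false false = inj₁ refl
polarity x true false = inj₂ refl
polarity x false true = inj₂ refl

nonTautological : ∀ {C l} → ¬ T (isTaut C) → l ∈ C → neg l ∉ C
nonTautological nt l∈ nl∈ = nt (any⁺ _ (lose l∈ (fromWitness nl∈)))

lookupD-just⇒∈ : ∀ E v {D} → lookupD E v ≡ just D → (v , D) ∈ E
lookupD-just⇒∈ ((y , D) ∷ E) v eq with y ≟ v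
lookupD-just⇒∈ ((y , D) ∷ E) v refl | yes refl = here refl
... | no _ = there (lookupD-just⇒∈ E v eq)

lookupD-∉ : ∀ E v → v ∉ map proj₁ E → lookupD E v ≡ nothing
lookupD-∉ [] v _ = refl
lookupD-∉ ((y , D) ∷ E) v v∉ with y ≟ v
... | yes refl = contradiction (here refl) v∉
... | no _ = lookupD-∉ E v (v∉ ∘ there)

lookupD-++ : ∀ A B v → lookupD (A ++ B) v ≡ (lookupD A v <∣> lookupD B v)
lookupD-++ [] B v = refl
lookupD-++ ((y , D) ∷ A) B v with y ≟ v
... | yes _ = refl
... | no _ = lookupD-++ A B v

lookupD-mapDeps : ∀ (g : List Var → List Var) E v →
                  lookupD (map (λ p → proj₁ p , g (proj₂ p)) E) v ≡ Maybe.map g (lookupD E v)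
lookupD-mapDeps g [] v = refl
lookupD-mapDeps g ((y , D) ∷ E) v with y ≟ v
... | yes _ = refl
... | no _ = lookupD-mapDeps g E v

lookupD-noDeps-∈ : ∀ W v → v ∈ W → lookupD (map (λ w → w , []) W) v ≡ just []
lookupD-noDeps-∈ (w ∷ W) v v∈ with w ≟ v
... | yes _ = refl
lookupD-noDeps-∈ (w ∷ W) v (here refl) | no w≢v = contradiction refl w≢v
lookupD-noDeps-∈ (w ∷ W) v (there v∈) | no _ = lookupD-noDeps-∈ W v v∈

lookupD-noDeps-∉ : ∀ W v → v ∉ W → lookupD (map (λ w → w , []) W) v ≡ nothing
lookupD-noDeps-∉ [] v _ = refl
lookupD-noDeps-∉ (w ∷ W) v v∉ with w ≟ v
... | yes refl = contradiction (here refl) v∉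
... | no _ = lookupD-noDeps-∉ W v (v∉ ∘ there)

lookupD-filter-kept : ∀ (b : Var → Bool) E v → T (b v) →
                      lookupD (filter (λ p → T? (b (proj₁ p))) E) v ≡ lookupD E v
lookupD-filter-kept b [] v _ = refl
lookupD-filter-kept b ((y , D) ∷ E) v bv with b y in eq
... | true with y ≟ v
...   | yes _ = refl
...   | no _ = lookupD-filter-kept b E v bv
lookupD-filter-kept b ((y , D) ∷ E) v bv | false with y ≟ v
...   | yes refl = ⊥-elim (subst T eq bv)
...   | no _ = lookupD-filter-kept b E v bv

lookupD-filter-nothing : ∀ (b : Var → Bool) E v → lookupD E v ≡ nothing →
                         lookupD (filter (λ p → T? (b (proj₁ p))) E) v ≡ nothing
lookupD-filter-nothing b [] v _ = refl
lookupD-filter-nothing b ((y , D) ∷ E) v eq with b y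
... | true with y ≟ v
...   | no _ = lookupD-filter-nothing b E v eq
lookupD-filter-nothing b ((y , D) ∷ E) v () | true | yes _
lookupD-filter-nothing b ((y , D) ∷ E) v eq | false with y ≟ v
...   | no _ = lookupD-filter-nothing b E v eq
lookupD-filter-nothing b ((y , D) ∷ E) v () | false | yes _

withoutVars : List Var → List Var → List Var
withoutVars V = filter (λ w → T? (notIn V w))

lookupD-abs : ∀ Φ V v →
              lookupD (exis (abs Φ V)) v
              ≡ (Maybe.map (withoutVars V) (lookupD (exis Φ) v) <∣> lookupD (map (λ w → w , []) V) v)
lookupD-abs Φ V v =
  trans (lookupD-++ (map (λ p → proj₁ p , withoutVars V (proj₂ p)) (exis Φ))
                    (map (λ w → w , []) V) v)
        (cong (_<∣> _) (lookupD-mapDeps (withoutVars V) (exis Φ) v))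

valVar-just : ∀ Ψ s α v {D} → lookupD (exis Ψ) v ≡ just D → valVar Ψ s α v ≡ s v α
valVar-just Ψ s α v eq rewrite eq = refl

valVar-nothing : ∀ Ψ s α v → lookupD (exis Ψ) v ≡ nothing → valVar Ψ s α v ≡ α v
valVar-nothing Ψ s α v eq rewrite eq = refl

valVar-cong-lookupD : ∀ Ψ Ψ′ s α v → lookupD (exis Ψ) v ≡ lookupD (exis Ψ′) v →
                      valVar Ψ s α v ≡ valVar Ψ′ s α v
valVar-cong-lookupD Ψ Ψ′ s α v eq = cong (λ m → if Maybe.is-just m then s v α else α v) eq

valLit-cong : ∀ {Ψ Ψ′ s s′ α β} v b → valVar Ψ s α v ≡ valVar Ψ′ s′ β v →
              valLit Ψ s α (v , b) ≡ valLit Ψ′ s′ β (v , b)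
valLit-cong v true eq = eq
valLit-cong v false eq = cong not eq

valLit-neg : ∀ Ψ s α l → valLit Ψ s α (neg l) ≡ not (valLit Ψ s α l)
valLit-neg Ψ s α (v , true) = refl
valLit-neg Ψ s α (v , false) = sym (not-involutive _)

dep-just : ∀ Ψ v {D} → lookupD (exis Ψ) v ≡ just D → dep Ψ v ≡ D
dep-just Ψ v eq rewrite eq = refl

dep-nothing : ∀ Ψ v → lookupD (exis Ψ) v ≡ nothing → dep Ψ v ≡ [ v ]
dep-nothing Ψ v eq rewrite eq = refl

Sat : DQBF → Candidate → (Var → Bool) → Clause → Set
Sat Ψ s α C = Any (λ l → valLit Ψ s α l ≡ true) C

Sat-exis : ∀ {Ψ Ψ′} s α {C} → exis Ψ ≡ exis Ψ′ → Sat Ψ s α C → Sat Ψ′ s α C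
Sat-exis {Ψ} {Ψ′} s α eq = Any.map λ {(v , b)} →
  trans (valLit-cong {Ψ′} {Ψ} v b
           (valVar-cong-lookupD Ψ′ Ψ s α v (cong (λ E → lookupD E v) (sym eq))))

UniversalsFree : DQBF → Set
UniversalsFree Ψ = ∀ v → v ∈ univ Ψ → lookupD (exis Ψ) v ≡ nothing

module UniversalReduction {Ψ : DQBF} (free : UniversalsFree Ψ) {s : Candidate} (loc : Local Ψ s)
                          (C : Clause) where

  kept : Var → Bool
  kept x = keepLit Ψ C (x , true)

  -- Reduced universals are set to falsify their literals in C; s cannot see them, so a kept
  -- literal of C must be true.
  falsify : (Var → Bool) → Var → Bool
  falsify α x = if kept x then α x else not ⌊ (x , true) ∈ₗ? C ⌋

  falsify-kept : ∀ α {x} → T (kept x) → falsify α x ≡ α x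
  falsify-kept α {x} t with kept x
  ... | true = refl

  falsify-reduced : ∀ α {x} → ¬ T (kept x) → falsify α x ≡ not ⌊ (x , true) ∈ₗ? C ⌋
  falsify-reduced α {x} r with kept x
  ... | true = contradiction _ r
  ... | false = refl

  reduced-universal : ∀ {x} → ¬ T (kept x) → x ∈ univ Ψ
  reduced-universal {x} r = toWitness (proj₁ (¬T-not∨ ⌊ x ∈ᵥ? univ Ψ ⌋ r))

  reduced∉deps : ∀ {x b z D} → ¬ T (kept z) → (x , b) ∈ C → lookupD (exis Ψ) x ≡ just D →
                 z ∉ D
  reduced∉deps {x} {b} {z} r k∈ eq z∈D =
    proj₂ (¬T-not∨ ⌊ z ∈ᵥ? univ Ψ ⌋ r) (any⁺ (depends Ψ z) (lose k∈ z-dep))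
    where
      z-dep : T (depends Ψ z (x , b))
      z-dep rewrite eq = fromWitness z∈D

  falsify-on-deps : ∀ α {x b z D} → (x , b) ∈ C → lookupD (exis Ψ) x ≡ just D → z ∈ D →
                    falsify α z ≡ α z
  falsify-on-deps α {z = z} k∈ eq z∈D with T? (kept z)
  ... | yes t = falsify-kept α t
  ... | no r = contradiction z∈D (reduced∉deps r k∈ eq)

  kept-value : ∀ α {x b} → T (kept x) → (x , b) ∈ C →
               valLit Ψ s α (x , b) ≡ valLit Ψ s (falsify α) (x , b)
  kept-value α {x} {b} t k∈ = valLit-cong x b agree
    where
      agree : valVar Ψ s α x ≡ valVar Ψ s (falsify α) x
      agree with lookupD (exis Ψ) x in eq
      ... | nothing = sym (falsify-kept α t)
      ... | just D = loc x D (lookupD-just⇒∈ (exis Ψ) x eq) α (falsify α)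
                       (λ z z∈D → sym (falsify-on-deps α k∈ eq z∈D))

  reduced-false : ¬ T (isTaut C) → ∀ α {x b} → ¬ T (kept x) → (x , b) ∈ C →
                  valLit Ψ s (falsify α) (x , b) ≡ false
  reduced-false nt α {x} {b} r k∈ = value b k∈
    where
      universal-value : valVar Ψ s (falsify α) x ≡ not ⌊ (x , true) ∈ₗ? C ⌋
      universal-value = trans (valVar-nothing Ψ s (falsify α) x (free x (reduced-universal r)))
                              (falsify-reduced α r)
      value : ∀ b → (x , b) ∈ C → valLit Ψ s (falsify α) (x , b) ≡ false
      value true k∈ = trans universal-value (cong not (⌊⌋-true _ k∈))
      value false k∈ =
        cong not (trans universal-value (cong not (⌊⌋-false _ (nonTautological nt k∈))))

  reduce-sound : ¬ T (isTaut C) → (∀ α → Sat Ψ s α C) →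
                 ∀ α → Sat Ψ s α (filter (λ l → T? (keepLit Ψ C l)) C)
  reduce-sound nt sat α with find (sat (falsify α))
  ... | (x , b) , k∈ , true-at-falsify with T? (kept x)
  ...   | yes t = lose (∈-filter⁺ (λ l → T? (keepLit Ψ C l)) k∈ t)
                           (trans (kept-value α t k∈) true-at-falsify)
  ...   | no r = contradiction (trans (sym (reduced-false nt α r k∈)) true-at-falsify) λ ()

  URc-sound : (∀ α → Sat Ψ s α C) → ∀ α → Sat Ψ s α (URc Ψ C)
  URc-sound sat α with isTaut C in taut
  ... | true = sat α
  ... | false = reduce-sound (subst T taut) sat α

UR-sound : ∀ {Ψ s} → UniversalsFree Ψ → IsSkolem Ψ s → IsSkolem (UR Ψ) s
UR-sound {Ψ} {s} free (loc , sat) = loc , λ α → map⁺ (tabulate λ C∈ →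
  Sat-exis s α refl (UniversalReduction.URc-sound free loc _ (λ β → All.lookup (sat β) C∈) α))

unitOf-just : ∀ D {u} → unitOf D ≡ just u → ∀ {k} → k ∈ D → k ≡ u
unitOf-just (l ∷ ls) eq k∈ with all (λ k → ⌊ k ≟ₗ l ⌋) ls in allEq
unitOf-just (l ∷ ls) refl (here refl) | true = refl
unitOf-just (l ∷ ls) refl (there k∈) | true = toWitness (T-all _ ls (subst T (sym allEq) _) k∈)

unitOf-true : ∀ {Ψ s α} D {u} → unitOf D ≡ just u → Sat Ψ s α D → valLit Ψ s α u ≡ true
unitOf-true {Ψ} {s} {α} D eq sat with find sat
... | k , k∈ , t = subst (λ l → valLit Ψ s α l ≡ true) (unitOf-just D eq k∈) t

unitsU⇒unitClause : ∀ Ψ {u} → u ∈ unitsU Ψ → ∃ λ D → D ∈ matrix Ψ × unitOf D ≡ just u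
unitsU⇒unitClause Ψ u∈
  with find (∈-concatMap⁻ (λ D → maybe′ [_] [] (unitOf D)) {xs = matrix Ψ}
               (proj₁ (∈-filter⁻ (λ l → T? (isExis Ψ (var l))) u∈)))
... | D , D∈ , u∈D with unitOf D in eq
...   | just u′ with u∈D
...     | here refl = D , D∈ , eq

assignUnits : DQBF → DQBF
assignUnits Ψ =
  univ Ψ
  ∶ filter (λ p → T? (notIn (map var (unitsU Ψ)) (proj₁ p))) (exis Ψ)
  ∶ map (filter (λ l → T? (not ⌊ neg l ∈ₗ? unitsU Ψ ⌋)))
        (filter (λ C → T? (not (any (λ l → ⌊ l ∈ₗ? unitsU Ψ ⌋) C))) (matrix Ψ))

assignUnits-free : ∀ {Ψ} → UniversalsFree Ψ → UniversalsFree (assignUnits Ψ)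
assignUnits-free {Ψ} free v v∈ = lookupD-filter-nothing _ (exis Ψ) v (free v v∈)

assignUnits-sound : ∀ {Ψ s} → IsSkolem Ψ s → IsSkolem (assignUnits Ψ) s
assignUnits-sound {Ψ} {s} (loc , sat) = local , λ α → tabulate (satisfied α)
  where
    U : List Lit
    U = unitsU Ψ

    local : Local (assignUnits Ψ) s
    local y D yD∈ = loc y D (proj₁ (∈-filter⁻ (λ p → T? (notIn (map var U) (proj₁ p))) yD∈))

    neg∉U : ∀ α {k} → valLit Ψ s α k ≡ true → neg k ∉ U
    neg∉U α {k} t nk∈ with unitsU⇒unitClause Ψ nk∈
    ... | D , D∈ , eq with trans (sym (valLit-neg Ψ s α k)) (unitOf-true D eq (All.lookup (sat α) D∈))
    ...   | nt rewrite t = contradiction nt λ ()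

    var∉units : ∀ {x b} → (x , b) ∉ U → neg (x , b) ∉ U → x ∉ map var U
    var∉units {x} {b} k∉ nk∉ x∈ with ∈-map⁻ var x∈
    ... | (_ , b′) , u∈ , refl with polarity x b b′
    ...   | inj₁ same = k∉ (subst (_∈ U) same u∈)
    ...   | inj₂ opposite = nk∉ (subst (_∈ U) opposite u∈)

    satisfied : ∀ α {C′} → C′ ∈ matrix (assignUnits Ψ) → Sat (assignUnits Ψ) s α C′
    satisfied α C′∈ with ∈-map⁻ (filter (λ l → T? (not ⌊ neg l ∈ₗ? U ⌋))) C′∈
    ... | C , C∈′ , refl with ∈-filter⁻ (λ C → T? (not (any (λ l → ⌊ l ∈ₗ? U ⌋) C))) C∈′
    ...   | C∈ , noUnit with find (All.lookup (sat α) C∈)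
    ...     | (x , b) , k∈ , t =
      lose (∈-filter⁺ _ k∈ (fromWitnessFalse (neg∉U α t))) (trans same-value t)
      where
        k∉U : (x , b) ∉ U
        k∉U k∈U = T-not⇒¬T _ noUnit (any⁺ _ (lose k∈ (fromWitness k∈U)))
        same-value : valLit (assignUnits Ψ) s α (x , b) ≡ valLit Ψ s α (x , b)
        same-value =
          valLit-cong x b (valVar-cong-lookupD (assignUnits Ψ) Ψ s α x
            (lookupD-filter-kept _ (exis Ψ) x (fromWitnessFalse (var∉units k∉U (neg∉U α t)))))

UP1-sound : ∀ {Ψ s} → UniversalsFree Ψ × IsSkolem Ψ s →
            UniversalsFree (UP1 Ψ) × IsSkolem (UP1 Ψ) s
UP1-sound {Ψ} (free , sk) = free′ , UR-sound free′ (assignUnits-sound sk)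
  where
    free′ : UniversalsFree (assignUnits Ψ)
    free′ = assignUnits-free {Ψ} free

iter-preserves : ∀ (P : DQBF → Set) f → (∀ {Φ} → P Φ → P (f Φ)) →
                 ∀ n {Φ} → P Φ → P (iter n f Φ)
iter-preserves P f step zero px = px
iter-preserves P f step (suc n) px = iter-preserves P f step n (step px)

UP-sound : ∀ {Ψ s} → UniversalsFree Ψ → IsSkolem Ψ s → IsSkolem (UP Ψ) s
UP-sound {Ψ} {s} free sk =
  proj₂ (iter-preserves (λ Φ → UniversalsFree Φ × IsSkolem Φ s) UP1 UP1-sound
                        (suc (length (exis Ψ))) (free , sk))

conflict⇒¬IsSkolem : ∀ {Ψ s} → UniversalsFree Ψ → IsSkolem Ψ s → ¬ Conflict Ψ
conflict⇒¬IsSkolem free sk conflict =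
  ¬Any[] (All.lookup (proj₂ (UP-sound free sk) (λ _ → true)) conflict)

module Abstraction {Ψ : DQBF} (wf : WellFormed Ψ) (C : Clause) {s : Candidate} (loc : Local Ψ s)
                   (α : Var → Bool) (falsified : ∀ l → l ∈ C → valLit Ψ s α l ≡ false) where

  open WellFormed wf

  V′ : List Var
  V′ = depClause Ψ C

  Ψᵃ : DQBF
  Ψᵃ = abs (Ψ ∧¬ C) V′

  -- In Ψᵃ the variables of dep(C) are existentials without dependencies, so they may be fixed
  -- to their α-values.
  fix : (Var → Bool) → Var → Bool
  fix β x = if ⌊ x ∈ᵥ? V′ ⌋ then α x else β x

  sᵃ : Candidate
  sᵃ y β = if ⌊ y ∈ᵥ? V′ ⌋ then α y else s y (fix β)

  fix-∈ : ∀ β {x} → x ∈ V′ → fix β x ≡ α x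
  fix-∈ β {x} x∈ rewrite ⌊⌋-true (x ∈ᵥ? V′) x∈ = refl

  fix-∉ : ∀ β {x} → x ∉ V′ → fix β x ≡ β x
  fix-∉ β {x} x∉ rewrite ⌊⌋-false (x ∈ᵥ? V′) x∉ = refl

  sᵃ-∈ : ∀ β {y} → y ∈ V′ → sᵃ y β ≡ α y
  sᵃ-∈ β {y} y∈ rewrite ⌊⌋-true (y ∈ᵥ? V′) y∈ = refl

  sᵃ-∉ : ∀ β {y} → y ∉ V′ → sᵃ y β ≡ s y (fix β)
  sᵃ-∉ β {y} y∉ rewrite ⌊⌋-false (y ∈ᵥ? V′) y∉ = refl

  dep⊆V′ : ∀ {l x} → l ∈ C → x ∈ dep Ψ (var l) → x ∈ V′
  dep⊆V′ l∈ x∈ = ∈-concatMap⁺ (λ l → dep Ψ (var l)) {xs = C} (lose l∈ x∈)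

  V′-universal : ∀ {v} → v ∈ V′ → lookupD (exis Ψ) v ≡ nothing
  V′-universal v∈ with find (∈-concatMap⁻ (λ l → dep Ψ (var l)) {xs = C} v∈)
  ... | l , _ , v∈dep with lookupD (exis Ψ) (var l) in eq
  ...   | just D =
    lookupD-∉ (exis Ψ) _
      (disjoint _ (depsUniv (var l) D (lookupD-just⇒∈ (exis Ψ) (var l) eq) _ v∈dep))
  ...   | nothing with v∈dep
  ...     | here refl = eq

  lookupᵃ-∈ : ∀ {v} → v ∈ V′ → lookupD (exis Ψᵃ) v ≡ just []
  lookupᵃ-∈ {v} v∈ =
    trans (lookupD-abs (Ψ ∧¬ C) V′ v)
          (cong₂ _<∣>_ (cong (Maybe.map (withoutVars V′)) (V′-universal v∈))
                       (lookupD-noDeps-∈ V′ v v∈))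

  lookupᵃ-∉ : ∀ {v m} → v ∉ V′ → lookupD (exis Ψ) v ≡ m →
              lookupD (exis Ψᵃ) v ≡ Maybe.map (withoutVars V′) m
  lookupᵃ-∉ {v} v∉ refl =
    trans (lookupD-abs (Ψ ∧¬ C) V′ v)
          (trans (cong (Maybe.map (withoutVars V′) (lookupD (exis Ψ) v) <∣>_)
                       (lookupD-noDeps-∉ V′ v v∉))
                 (<∣>-identityʳ _))

  valVarᵃ : ∀ β v → valVar Ψᵃ sᵃ β v ≡ valVar Ψ s (fix β) v
  valVarᵃ β v = by-membership (v ∈ᵥ? V′)
    where
      open ≡-Reasoning
      by-membership : Dec (v ∈ V′) → valVar Ψᵃ sᵃ β v ≡ valVar Ψ s (fix β) v
      by-membership (yes v∈) = begin
        valVar Ψᵃ sᵃ β v      ≡⟨ valVar-just Ψᵃ sᵃ β v (lookupᵃ-∈ v∈) ⟩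
        sᵃ v β                ≡⟨ sᵃ-∈ β v∈ ⟩
        α v                   ≡⟨ fix-∈ β v∈ ⟨
        fix β v               ≡⟨ valVar-nothing Ψ s (fix β) v (V′-universal v∈) ⟨
        valVar Ψ s (fix β) v  ∎
      by-membership (no v∉) with lookupD (exis Ψ) v in eq
      ... | just D = trans (valVar-just Ψᵃ sᵃ β v (lookupᵃ-∉ v∉ eq)) (sᵃ-∉ β v∉)
      ... | nothing = trans (valVar-nothing Ψᵃ sᵃ β v (lookupᵃ-∉ v∉ eq)) (sym (fix-∉ β v∉))

  valLitᵃ : ∀ β l → valLit Ψᵃ sᵃ β l ≡ valLit Ψ s (fix β) l
  valLitᵃ β (v , b) = valLit-cong v b (valVarᵃ β v)

  fix-on-C : ∀ β {l} → l ∈ C → valLit Ψ s (fix β) l ≡ valLit Ψ s α l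
  fix-on-C β {x , b} l∈ = valLit-cong x b agree
    where
      agree : valVar Ψ s (fix β) x ≡ valVar Ψ s α x
      agree with lookupD (exis Ψ) x in eq
      ... | just D = loc x D (lookupD-just⇒∈ (exis Ψ) x eq) (fix β) α
                       (λ z z∈D → fix-∈ β (dep⊆V′ l∈ (subst (z ∈_) (sym (dep-just Ψ x eq)) z∈D)))
      ... | nothing = fix-∈ β (dep⊆V′ l∈ (subst (x ∈_) (sym (dep-nothing Ψ x eq)) (here refl)))

  freeᵃ : UniversalsFree Ψᵃ
  freeᵃ v v∈ with ∈-filter⁻ (λ w → T? (notIn V′ w)) v∈
  ... | v∈univ , v∉ = lookupᵃ-∉ (toWitnessFalse v∉) (lookupD-∉ (exis Ψ) v (disjoint v v∈univ))

  fix-agrees : ∀ {β₁ β₂} D → (∀ x → x ∈ withoutVars V′ D → β₁ x ≡ β₂ x) →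
               ∀ x → x ∈ D → fix β₁ x ≡ fix β₂ x
  fix-agrees D agree x x∈ with x ∈ᵥ? V′
  ... | yes _ = refl
  ... | no x∉V′ = agree x (∈-filter⁺ _ x∈ (fromWitnessFalse x∉V′))

  localᵃ : Local Ψᵃ sᵃ
  localᵃ y D′ yD∈ β₁ β₂ agree
    with ∈-++⁻ (map (λ p → proj₁ p , withoutVars V′ (proj₂ p)) (exis Ψ)) yD∈
  ... | inj₂ y∈noDeps with ∈-map⁻ (λ w → w , []) y∈noDeps
  ...   | _ , y∈V′ , refl = trans (sᵃ-∈ β₁ y∈V′) (sym (sᵃ-∈ β₂ y∈V′))
  localᵃ y D′ yD∈ β₁ β₂ agree | inj₁ y∈abs
    with ∈-map⁻ (λ p → proj₁ p , withoutVars V′ (proj₂ p)) y∈abs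
  ...   | (_ , D) , yD∈Ψ , refl with y ∈ᵥ? V′
  ...     | yes _ = refl
  ...     | no _ = loc y D yD∈Ψ (fix β₁) (fix β₂) (fix-agrees D agree)

  IsSkolemᵃ : (∀ β → All (Sat Ψ s β) (matrix Ψ)) → IsSkolem Ψᵃ sᵃ
  IsSkolemᵃ sat = localᵃ , λ β →
    ++⁺ (All.map (Any.map λ {l} → trans (valLitᵃ β l)) (sat (fix β)))
        (map⁺ (tabulate λ {l} l∈ → here (negation-true β l∈)))
    where
      negation-true : ∀ β {l} → l ∈ C → valLit Ψᵃ sᵃ β (neg l) ≡ true
      negation-true β {l} l∈ = begin
        valLit Ψᵃ sᵃ β (neg l)        ≡⟨ valLitᵃ β (neg l) ⟩
        valLit Ψ s (fix β) (neg l)    ≡⟨ valLit-neg Ψ s (fix β) l ⟩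
        not (valLit Ψ s (fix β) l)    ≡⟨ cong not (trans (fix-on-C β l∈) (falsified l l∈)) ⟩
        true                          ∎
        where open ≡-Reasoning

IsSkolem⇒Sat : ∀ {Ψ s} → WellFormed Ψ → ∀ C → Conflict (abs (Ψ ∧¬ C) (depClause Ψ C)) →
               IsSkolem Ψ s → ∀ α → Sat Ψ s α C
IsSkolem⇒Sat {Ψ} {s} wf C conflict (loc , sat) α with any? (λ l → valLit Ψ s α l ≟ᵇ true) C
... | yes satisfied = satisfied
... | no unsatisfied = contradiction conflict (conflict⇒¬IsSkolem freeᵃ (IsSkolemᵃ sat))
  where
    falsified : ∀ l → l ∈ C → valLit Ψ s α l ≡ false
    falsified l l∈ = ¬-not (unsatisfied ∘ lose l∈)
    open Abstraction wf C loc α falsified using (freeᵃ; IsSkolemᵃ)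

mainTheorem1 : (Ψ : DQBF) → WellFormed Ψ → (C : Clause) → Compatible Ψ C →
               Conflict (abs (Ψ ∧¬ C) (depClause Ψ C)) →
               Ψ ≡ₛ (Ψ ∧ᶜ C)
mainTheorem1 Ψ wf C _ conflict s = mk⇔ add-C drop-C
  where
    add-C : IsSkolem Ψ s → IsSkolem (Ψ ∧ᶜ C) s
    add-C sk@(loc , sat) = loc , λ α →
      All.map (Sat-exis s α refl) (++⁺ (sat α) (IsSkolem⇒Sat wf C conflict sk α ∷ []))

    drop-C : IsSkolem (Ψ ∧ᶜ C) s → IsSkolem Ψ s
    drop-C (loc , sat) = loc , λ α → All.map (Sat-exis s α refl) (++⁻ˡ (matrix Ψ) (sat α))
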